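{- Let $k,l\ge 2$ and $m\ge 1$ be integers. Let $P$ be a $k$-permutation matrix, $Q$ an $l$-permutation matrix, $t=kl$ and $R=P\# Q$. Then \[ \mathrm{ex}(mt,R) < (mt)^2 - k\cdot\big((ml-1)^2-\mathrm{ex}(ml-1,Q)\big). \]
   Context: A $k$-permutation matrix is a $k\times k$ binary matrix with exactly one $1$-entry in every row and column. If $P$ has $1$-entries at $(i,\pi(i))$, $i\in[k]$, and $Q$ has $1$-entries at $(j,\rho(j))$, $j\in[l]$, the grid product $P\# Q$ is the $kl$-permutation matrix with $1$-entries exactly at the positions $((j-1)k+i,\ (\pi(i)-1)l+\rho(j))$ for $i\in[k]$, $j\in[l]$. A binary matrix $A$ contains $B$ if $B$ can be obtained from $A$ by deleting some rows, some columns, and changing some $1$-entries to $0$-entries; otherwise $A$ avoids $B$. $\mathrm{ex}(n,B)$ is the maximum number of $1$-entries in an $n\times n$ binary matrix avoiding $B$. -}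

module Defs where

open import Data.Nat using (ℕ; zero; suc; _+_; _*_; _≤_)
open import Data.Bool using (Bool; true; false; if_then_else_)
open import Data.Fin using (Fin; toℕ; _<_) renaming (zero to fz; suc to fs)
open import Data.Fin.Permutation using (Permutation′; _⟨$⟩ʳ_)
open import Data.Product using (Σ; ∃; _×_; _,_)
open import Relation.Nullary using (¬_)
open import Relation.Binary.PropositionalEquality using (_≡_)

-- An r×c binary matrix (0-indexed rows/columns); true = 1-entry.
BMat : ℕ → ℕ → Set
BMat r c = Fin r → Fin c → Bool

-- A pattern matrix given by its set of 1-entries.
Pattern : ℕ → ℕ → Set₁
Pattern r c = Fin r → Fin c → Set

sumFin : (n : ℕ) → (Fin n → ℕ) → ℕ
sumFin zero    f = 0
sumFin (suc n) f = f fz + sumFin n (λ i → f (fs i))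

ones : ∀ {r c} → BMat r c → ℕ
ones {r} {c} A = sumFin r (λ i → sumFin c (λ j → if A i j then 1 else 0))

permMat : ∀ {k} → Permutation′ k → Pattern k k
permMat π i j = π ⟨$⟩ʳ i ≡ j

grid : ∀ {k l} → Permutation′ k → Permutation′ l → Pattern (k * l) (k * l)
grid {k} {l} π ρ r c =
  Σ (Fin k) λ i → Σ (Fin l) λ j →
    (toℕ r ≡ toℕ j * k + toℕ i) × (toℕ c ≡ toℕ (π ⟨$⟩ʳ i) * l + toℕ (ρ ⟨$⟩ʳ j))

-- A contains B: B is obtained from A by deleting rows and columns and turning
-- 1-entries into 0-entries, i.e. there are strictly increasing row and column
-- embeddings under which every 1-entry of B lands on a 1-entry of A.
Contains : ∀ {n₁ n₂ a b} → BMat n₁ n₂ → Pattern a b → Set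
Contains {n₁} {n₂} {a} {b} A B =
  Σ (Fin a → Fin n₁) λ f → Σ (Fin b → Fin n₂) λ g →
    (∀ i i′ → i < i′ → f i < f i′) ×
    (∀ j j′ → j < j′ → g j < g j′) ×
    (∀ i j → B i j → A (f i) (g j) ≡ true)

Avoids : ∀ {n₁ n₂ a b} → BMat n₁ n₂ → Pattern a b → Set
Avoids A B = ¬ Contains A B

IsEx : ∀ {a b} → ℕ → Pattern a b → ℕ → Set
IsEx n B e =
  (Σ (BMat n n) λ A → Avoids A B × ones A ≡ e) ×
  (∀ (A : BMat n n) → Avoids A B → ones A ≤ e)

module Submission where

-- Let L = ml, cut the columns of an mt × mt matrix A avoiding R = P # Q into k blocks of width L,
-- and for each offset u < k cut its rows into windows of k consecutive rows starting at gk + u.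
-- Compress A to an (L − 1) × L matrix (only L − 1 windows fit for every offset) whose (g, c) entry
-- is 1 iff the copy of P on window g, placed in column c of every column block, is present in A.
-- Different (u, g, c, block) use different cells of A, so the k compressed matrices together have
-- at most as many 0-entries as A. If A had at most k·D zeros, D = (L − 1)² − ex(L − 1, Q), some
-- compressed matrix would have at most D zeros; deleting a column through one of them leaves an
-- (L − 1) × (L − 1) matrix with more than ex(L − 1, Q) ones, hence a copy of Q, and that copy
-- lifts to a copy of P # Q in A. If D = 0, A would have no zeros at all and so would contain R.

open import Algebra.Properties.CommutativeSemigroup using (interchange; x∙yz≈y∙xz)
open import Data.Bool using (Bool; true; false; if_then_else_; not; _∧_)
open import Data.Fin as Fin using (Fin; toℕ; fromℕ<; inject≤; remQuot; cast) renaming (zero to fz; suc to fs)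
open import Data.Fin.Permutation using (Permutation′; _⟨$⟩ʳ_; _⟨$⟩ˡ_; inverseˡ)
open import Data.Fin.Properties
  using ( toℕ<n; toℕ-fromℕ<; fromℕ<-toℕ; toℕ-inject≤; toℕ-injective; toℕ-cast
        ; toℕ-combine; combine-remQuot; remQuot-combine)
open import Data.Nat
open import Data.Nat.Properties
open import Data.Product using (∃; _×_; _,_; proj₁; proj₂)
open import Data.Sum using (_⊎_; inj₁; inj₂)
open import Function using (_∘_; const)
open import Relation.Binary using (tri<; tri≈; tri>)
open import Relation.Binary.PropositionalEquality
open import Relation.Nullary using (yes; no; contradiction)

open import Defs

∑ : ℕ → (ℕ → ℕ) → ℕ
∑ zero    f = 0
∑ (suc n) f = f 0 + ∑ n (f ∘ suc)

∑-cong : ∀ n {f g : ℕ → ℕ} → (∀ x → x < n → f x ≡ g x) → ∑ n f ≡ ∑ n g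
∑-cong zero    eq = refl
∑-cong (suc n) eq = cong₂ _+_ (eq 0 z<s) (∑-cong n (λ x x<n → eq (suc x) (s<s x<n)))

∑-mono-≤ : ∀ n {f g : ℕ → ℕ} → (∀ x → x < n → f x ≤ g x) → ∑ n f ≤ ∑ n g
∑-mono-≤ zero    le = z≤n
∑-mono-≤ (suc n) le = +-mono-≤ (le 0 z<s) (∑-mono-≤ n (λ x x<n → le (suc x) (s<s x<n)))

∑-const : ∀ n c → ∑ n (const c) ≡ n * c
∑-const zero    c = refl
∑-const (suc n) c = cong (c +_) (∑-const n c)

∑-distrib-+ : ∀ n (f g : ℕ → ℕ) → ∑ n (λ x → f x + g x) ≡ ∑ n f + ∑ n g
∑-distrib-+ zero    f g = refl
∑-distrib-+ (suc n) f g =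
  trans (cong ((f 0 + g 0) +_) (∑-distrib-+ n (f ∘ suc) (g ∘ suc)))
        (interchange +-commutativeSemigroup (f 0) (g 0) _ _)

∑-swap : ∀ a b (f : ℕ → ℕ → ℕ) → ∑ a (λ x → ∑ b (f x)) ≡ ∑ b (λ y → ∑ a (λ x → f x y))
∑-swap zero    b f = sym (trans (∑-const b 0) (*-zeroʳ b))
∑-swap (suc a) b f = trans (cong (∑ b (f 0) +_) (∑-swap a b (f ∘ suc)))
                           (sym (∑-distrib-+ b (f 0) (λ y → ∑ a (λ x → f (suc x) y))))

∑-swap₃ : ∀ a b c (f : ℕ → ℕ → ℕ → ℕ) →
  ∑ a (λ x → ∑ b (λ y → ∑ c (f x y))) ≡ ∑ c (λ z → ∑ a (λ x → ∑ b (λ y → f x y z)))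
∑-swap₃ a b c f = trans (∑-cong a (λ x _ → ∑-swap b c (f x))) (∑-swap a c (λ x z → ∑ b (λ y → f x y z)))

∑-+ : ∀ a b (h : ℕ → ℕ) → ∑ (a + b) h ≡ ∑ a h + ∑ b (λ w → h (a + w))
∑-+ zero    b h = refl
∑-+ (suc a) b h = trans (cong (h 0 +_) (∑-+ a b (h ∘ suc))) (sym (+-assoc (h 0) _ _))

∑-* : ∀ a k (h : ℕ → ℕ) → ∑ (a * k) h ≡ ∑ a (λ g → ∑ k (λ u → h (g * k + u)))
∑-* zero    k h = refl
∑-* (suc a) k h = trans (∑-+ k (a * k) h) (cong (∑ k h +_) (trans (∑-* a k (λ w → h (k + w)))
  (∑-cong a (λ g _ → ∑-cong k (λ u _ → cong h (sym (+-assoc k (g * k) u)))))))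

∑-shift : ∀ a i (h : ℕ → ℕ) → ∑ a (λ w → h (w + i)) ≤ ∑ (i + a) h
∑-shift a i h = begin
  ∑ a (λ w → h (w + i))           ≡⟨ ∑-cong a (λ w _ → cong h (+-comm w i)) ⟩
  ∑ a (λ w → h (i + w))           ≤⟨ m≤n+m _ (∑ i h) ⟩
  ∑ i h + ∑ a (λ w → h (i + w))   ≡⟨ ∑-+ i a h ⟨
  ∑ (i + a) h                     ∎
  where open ≤-Reasoning

∑-monoˡ-≤ : ∀ {a b} (h : ℕ → ℕ) → a ≤ b → ∑ a h ≤ ∑ b h
∑-monoˡ-≤ {a} h a≤b with m≤n⇒∃[o]m+o≡n a≤b
... | o , refl = subst (∑ a h ≤_) (sym (∑-+ a o h)) (m≤m+n _ _)

term≤∑ : ∀ n (h : ℕ → ℕ) {x} → x < n → h x ≤ ∑ n h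
term≤∑ (suc n) h {zero}  _         = m≤m+n _ _
term≤∑ (suc n) h {suc x} (s<s x<n) = ≤-trans (term≤∑ n (h ∘ suc) x<n) (m≤n+m _ _)

∑-positive : ∀ n (h : ℕ → ℕ) → 0 < ∑ n h → ∃ λ x → x < n × 0 < h x
∑-positive (suc n) h ∑>0 with 0 <? h 0
... | yes h0>0 = 0 , z<s , h0>0
... | no  h0≯0 with ∑-positive n (h ∘ suc) (<-≤-trans ∑>0 (+-monoˡ-≤ _ (≮⇒≥ h0≯0)))
...   | x , x<n , hx>0 = suc x , s<s x<n , hx>0

pigeonhole : ∀ k D (h : ℕ → ℕ) → ∑ k h < k * suc D → ∃ λ u → u < k × h u ≤ D
pigeonhole (suc k) D h ∑<k*D with h 0 ≤? D
... | yes h0≤D = 0 , z<s , h0≤D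
... | no  h0≰D with pigeonhole k D (h ∘ suc)
                      (+-cancelˡ-< (suc D) _ _ (≤-<-trans (+-monoˡ-≤ _ (≰⇒> h0≰D)) ∑<k*D))
...   | u , u<k , hu≤D = suc u , s<s u<k , hu≤D

punchInℕ : ℕ → ℕ → ℕ
punchInℕ zero    x       = suc x
punchInℕ (suc c) zero    = zero
punchInℕ (suc c) (suc x) = suc (punchInℕ c x)

punchInℕ-< : ∀ c {x m} → x < m → punchInℕ c x < suc m
punchInℕ-< zero    x<m                 = s<s x<m
punchInℕ-< (suc c) {zero}  {suc m} _   = z<s
punchInℕ-< (suc c) {suc x} {suc m} (s<s x<m) = s<s (punchInℕ-< c x<m)

punchInℕ-mono-< : ∀ c {x y} → x < y → punchInℕ c x < punchInℕ c y
punchInℕ-mono-< zero    x<y = s<s x<y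
punchInℕ-mono-< (suc c) {zero}  {suc y} _         = z<s
punchInℕ-mono-< (suc c) {suc x} {suc y} (s<s x<y) = s<s (punchInℕ-mono-< c x<y)

∑-punchIn : ∀ n c (h : ℕ → ℕ) → c < suc n → ∑ (suc n) h ≡ h c + ∑ n (h ∘ punchInℕ c)
∑-punchIn n       zero    h _         = refl
∑-punchIn (suc n) (suc c) h (s<s c<n) =
  trans (cong (h 0 +_) (∑-punchIn n c (h ∘ suc) c<n)) (x∙yz≈y∙xz +-commutativeSemigroup (h 0) (h (suc c)) _)

∑∑-punchIn : ∀ a b c (h : ℕ → ℕ → ℕ) → c < suc b →
  ∑ a (λ x → ∑ (suc b) (h x)) ≡ ∑ a (λ x → h x c) + ∑ a (λ x → ∑ b (h x ∘ punchInℕ c))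
∑∑-punchIn a b c h c<1+b = trans (∑-cong a (λ x _ → ∑-punchIn b c (h x) c<1+b)) (∑-distrib-+ a _ _)

removable-column : ∀ a b D (h : ℕ → ℕ → ℕ) → 0 < D → ∑ a (λ x → ∑ (suc b) (h x)) ≤ D →
  ∃ λ c → c < suc b × ∑ a (λ x → ∑ b (h x ∘ punchInℕ c)) < D
removable-column a b D h D>0 total≤D with 0 <? ∑ a (λ x → ∑ (suc b) (h x))
... | no total≯0 = 0 , z<s , ≤-<-trans (≤-trans rest≤total (≮⇒≥ total≯0)) D>0
  where
  rest≤total : ∑ a (λ x → ∑ b (h x ∘ suc)) ≤ ∑ a (λ x → ∑ (suc b) (h x))
  rest≤total = subst (∑ a (λ x → ∑ b (h x ∘ suc)) ≤_) (sym (∑∑-punchIn a b 0 h z<s)) (m≤n+m _ _)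
... | yes total>0 with ∑-positive a _ total>0
...   | x , x<a , row>0 with ∑-positive (suc b) (h x) row>0
...     | c , c<1+b , hxc>0 = c , c<1+b , (begin-strict
  ∑ a (λ x → ∑ b (h x ∘ punchInℕ c))
    <⟨ +-monoˡ-< _ (<-≤-trans hxc>0 (term≤∑ a (λ x → h x c) x<a)) ⟩
  ∑ a (λ x → h x c) + ∑ a (λ x → ∑ b (h x ∘ punchInℕ c))      ≡⟨ ∑∑-punchIn a b c h c<1+b ⟨
  ∑ a (λ x → ∑ (suc b) (h x))                                 ≤⟨ total≤D ⟩
  D                                                           ∎)
  where open ≤-Reasoning

bit : Bool → ℕ
bit b = if b then 1 else 0

bit+bit-not : ∀ b → bit b + bit (not b) ≡ 1
bit+bit-not true  = refl
bit+bit-not false = refl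

all< : ℕ → (ℕ → Bool) → Bool
all< zero    p = true
all< (suc n) p = p 0 ∧ all< n (p ∘ suc)

all<-true : ∀ n p → all< n p ≡ true → ∀ {x} → x < n → p x ≡ true
all<-true (suc n) p eq {zero}  _         with p 0 | eq
... | true | _   = refl
all<-true (suc n) p eq {suc x} (s<s x<n) with p 0 | eq
... | true | eq′ = all<-true n (p ∘ suc) eq′ x<n

bit-not-all<≤∑ : ∀ n p → bit (not (all< n p)) ≤ ∑ n (λ x → bit (not (p x)))
bit-not-all<≤∑ zero    p = z≤n
bit-not-all<≤∑ (suc n) p with p 0
... | true  = bit-not-all<≤∑ n (p ∘ suc)
... | false = s≤s z≤n

∑∑bit+∑∑bit-not : ∀ a b (B : ℕ → ℕ → Bool) →
  ∑ a (λ x → ∑ b (λ y → bit (B x y))) + ∑ a (λ x → ∑ b (λ y → bit (not (B x y)))) ≡ a * b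
∑∑bit+∑∑bit-not a b B = begin
  ∑ a (λ x → ∑ b (λ y → bit (B x y))) + ∑ a (λ x → ∑ b (λ y → bit (not (B x y))))
    ≡⟨ ∑-distrib-+ a _ _ ⟨
  ∑ a (λ x → ∑ b (λ y → bit (B x y)) + ∑ b (λ y → bit (not (B x y))))
    ≡⟨ ∑-cong a (λ x _ → ∑-distrib-+ b _ _) ⟨
  ∑ a (λ x → ∑ b (λ y → bit (B x y) + bit (not (B x y))))
    ≡⟨ ∑-cong a (λ x _ → trans (∑-cong b (λ y _ → bit+bit-not (B x y))) (trans (∑-const b 1) (*-identityʳ b))) ⟩
  ∑ a (const b)
    ≡⟨ ∑-const a b ⟩
  a * b ∎
  where open ≡-Reasoning

sumFin≡∑ : ∀ n {F : Fin n → ℕ} {h : ℕ → ℕ} → (∀ i → F i ≡ h (toℕ i)) → sumFin n F ≡ ∑ n h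
sumFin≡∑ zero    eq = refl
sumFin≡∑ (suc n) eq = cong₂ _+_ (eq fz) (sumFin≡∑ n (eq ∘ fs))

zeros : ∀ {r c} → BMat r c → ℕ
zeros {r} {c} A = sumFin r (λ i → sumFin c (λ j → bit (not (A i j))))

entry : ∀ {r c} → BMat r c → ℕ → ℕ → Bool
entry {r} {c} A x y with x <? r | y <? c
... | yes x<r | yes y<c = A (fromℕ< x<r) (fromℕ< y<c)
... | _       | _       = false

entry-toℕ : ∀ {r c} (A : BMat r c) i j → entry A (toℕ i) (toℕ j) ≡ A i j
entry-toℕ {r} {c} A i j with toℕ i <? r | toℕ j <? c
... | yes i<r | yes j<c = cong₂ A (fromℕ<-toℕ i i<r) (fromℕ<-toℕ j j<c)
... | no  i≮r | _       = contradiction (toℕ<n i) i≮r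
... | yes _   | no j≮c  = contradiction (toℕ<n j) j≮c

ones≡∑ : ∀ {r c} (A : BMat r c) → ones A ≡ ∑ r (λ x → ∑ c (λ y → bit (entry A x y)))
ones≡∑ {r} {c} A = sumFin≡∑ r (λ i → sumFin≡∑ c (λ j → cong bit (sym (entry-toℕ A i j))))

zeros≡∑ : ∀ {r c} (A : BMat r c) → zeros A ≡ ∑ r (λ x → ∑ c (λ y → bit (not (entry A x y))))
zeros≡∑ {r} {c} A = sumFin≡∑ r (λ i → sumFin≡∑ c (λ j → cong (bit ∘ not) (sym (entry-toℕ A i j))))

ones+zeros : ∀ {r c} (A : BMat r c) → ones A + zeros A ≡ r * c
ones+zeros {r} {c} A = trans (cong₂ _+_ (ones≡∑ A) (zeros≡∑ A)) (∑∑bit+∑∑bit-not r c (entry A))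

zeros<∸⇒<ones : ∀ {r c} (A : BMat r c) e → zeros A < r * c ∸ e → e < ones A
zeros<∸⇒<ones {r} {c} A e zs<rc∸e = ≰⇒> λ ones≤e → <⇒≱ zs<rc∸e
  (m≤n+o⇒m∸n≤o (r * c) e (subst (_≤ e + zeros A) (ones+zeros A) (+-monoˡ-≤ (zeros A) ones≤e)))

zeros≡0⇒true : ∀ {r c} (A : BMat r c) → zeros A ≡ 0 → ∀ i j → A i j ≡ true
zeros≡0⇒true {r} {c} A zs≡0 i j = bit-not≡0 (n≤0⇒n≡0 (begin
  bit (not (A i j))                                     ≡⟨ cong (bit ∘ not) (entry-toℕ A i j) ⟨
  bit (not (entry A (toℕ i) (toℕ j)))                   ≤⟨ term≤∑ c _ (toℕ<n j) ⟩
  ∑ c (λ y → bit (not (entry A (toℕ i) y)))             ≤⟨ term≤∑ r (λ x → ∑ c (bit ∘ not ∘ entry A x)) (toℕ<n i) ⟩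
  ∑ r (λ x → ∑ c (λ y → bit (not (entry A x y))))       ≡⟨ trans (sym (zeros≡∑ A)) zs≡0 ⟩
  0                                                     ∎))
  where
  open ≤-Reasoning
  bit-not≡0 : ∀ {b} → bit (not b) ≡ 0 → b ≡ true
  bit-not≡0 {true} _ = refl

zeros≡0⇒contains : ∀ {r c a b} (A : BMat r c) (B : Pattern a b) →
  zeros A ≡ 0 → a ≤ r → b ≤ c → Contains A B
zeros≡0⇒contains A B zs≡0 a≤r b≤c =
  (λ i → inject≤ i a≤r) , (λ j → inject≤ j b≤c) ,
  (λ i i′ i<i′ → subst₂ _<_ (sym (toℕ-inject≤ i a≤r)) (sym (toℕ-inject≤ i′ a≤r)) i<i′) ,
  (λ j j′ j<j′ → subst₂ _<_ (sym (toℕ-inject≤ j b≤c)) (sym (toℕ-inject≤ j′ b≤c)) j<j′) ,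
  (λ i j _ → zeros≡0⇒true A zs≡0 _ _)

*+-< : ∀ B {q q′ s} s′ → q < q′ → s < B + s′ → q * B + s < q′ * B + s′
*+-< B {q} {q′} {s} s′ q<q′ s<B+s′ = begin-strict
  q * B + s          <⟨ +-monoʳ-< (q * B) s<B+s′ ⟩
  q * B + (B + s′)   ≡⟨ +-assoc (q * B) B s′ ⟨
  q * B + B + s′     ≡⟨ cong (_+ s′) (+-comm (q * B) B) ⟩
  suc q * B + s′     ≤⟨ +-monoˡ-≤ s′ (*-monoˡ-≤ B q<q′) ⟩
  q′ * B + s′        ∎
  where open ≤-Reasoning

digits-lex : ∀ b {q r q′ r′} → r′ < b → q * b + r < q′ * b + r′ → q < q′ ⊎ (q ≡ q′ × r < r′)
digits-lex b {q} {r} {q′} {r′} r′<b lt with <-cmp q q′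
... | tri< q<q′ _ _ = inj₁ q<q′
... | tri≈ _ refl _ = inj₂ (refl , +-cancelˡ-< (q * b) r r′ lt)
... | tri> _ _ q′<q = contradiction lt (<-asym (*+-< b r q′<q (<-≤-trans r′<b (m≤m+n b r))))

toℕ-remQuot : ∀ {a} b (x : Fin (a * b)) →
  toℕ x ≡ toℕ (proj₁ (remQuot {a} b x)) * b + toℕ (proj₂ (remQuot {a} b x))
toℕ-remQuot {a} b x = begin
  toℕ x                                       ≡⟨ cong toℕ (combine-remQuot {a} b x) ⟨
  toℕ (Fin.combine q r)                       ≡⟨ toℕ-combine q r ⟩
  b * toℕ q + toℕ r                           ≡⟨ cong (_+ toℕ r) (*-comm b (toℕ q)) ⟩
  toℕ q * b + toℕ r                           ∎
  where open ≡-Reasoning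
        q = proj₁ (remQuot {a} b x)
        r = proj₂ (remQuot {a} b x)

remQuot-digits : ∀ {a} b (x : Fin (a * b)) q r → toℕ x ≡ toℕ q * b + toℕ r → remQuot {a} b x ≡ (q , r)
remQuot-digits {a} b x q r eq = trans (cong (remQuot b) (toℕ-injective (begin
  toℕ x                  ≡⟨ eq ⟩
  toℕ q * b + toℕ r      ≡⟨ cong (_+ toℕ r) (*-comm (toℕ q) b) ⟩
  b * toℕ q + toℕ r      ≡⟨ toℕ-combine q r ⟨
  toℕ (Fin.combine q r)  ∎))) (remQuot-combine q r)
  where open ≡-Reasoning

module _ {a b} (H : Fin a → ℕ) (Ψ : Fin b → ℕ) where

  digitMap : Fin (a * b) → ℕ
  digitMap x = H (proj₁ (remQuot {a} b x)) + Ψ (proj₂ (remQuot {a} b x))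

  digitMap-digits : ∀ x q r → toℕ x ≡ toℕ q * b + toℕ r → digitMap x ≡ H q + Ψ r
  digitMap-digits x q r eq = cong (λ (q , r) → H q + Ψ r) (remQuot-digits {a} b x q r eq)

  digitMap-mono : (∀ {q q′} r r′ → q Fin.< q′ → H q + Ψ r < H q′ + Ψ r′) →
                  (∀ {r r′} → r Fin.< r′ → Ψ r < Ψ r′) →
                  ∀ {x y} → x Fin.< y → digitMap x < digitMap y
  digitMap-mono H-step Ψ-mono {x} {y} x<y
    with digits-lex b (toℕ<n (proj₂ (remQuot {a} b y)))
                      (subst₂ _<_ (toℕ-remQuot {a} b x) (toℕ-remQuot {a} b y) x<y)
  ... | inj₁ q<q′        = H-step _ _ q<q′
  ... | inj₂ (q≡q′ , r<r′) rewrite toℕ-injective q≡q′ = +-monoʳ-< _ (Ψ-mono r<r′)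

inverseℕ : ∀ {k} → Permutation′ k → ℕ → ℕ
inverseℕ {k} π b with b <? k
... | yes b<k = toℕ (π ⟨$⟩ˡ fromℕ< b<k)
... | no  _   = 0

inverseℕ-< : ∀ {k} (π : Permutation′ k) {b} → b < k → inverseℕ π b < k
inverseℕ-< {k} π {b} b<k with b <? k
... | yes _   = toℕ<n _
... | no  b≮k = contradiction b<k b≮k

inverseℕ-toℕ : ∀ {k} (π : Permutation′ k) i → inverseℕ π (toℕ (π ⟨$⟩ʳ i)) ≡ toℕ i
inverseℕ-toℕ {k} π i with toℕ (π ⟨$⟩ʳ i) <? k
... | yes πi<k = cong toℕ (trans (cong (π ⟨$⟩ˡ_) (fromℕ<-toℕ _ πi<k)) (inverseˡ π))
... | no  πi≮k = contradiction (toℕ<n _) πi≮k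

module Compression {k l L′ n : ℕ} (l≤L : l ≤ suc L′) (n≡L*k : n ≡ suc L′ * k)
                   (π : Permutation′ k) (ρ : Permutation′ l) (A : BMat n n) where

  L : ℕ
  L = suc L′

  n≡k*L : n ≡ k * L
  n≡k*L = trans n≡L*k (*-comm L k)

  -- window u g c = 1 iff A has a 1-entry at (g k + u + π⁻¹(b), b L + c) in every column block b,
  -- i.e. the k rows from g k + u on carry a copy of P spread over column c of the k column blocks.
  window : ℕ → ℕ → ℕ → Bool
  window u g c = all< k (λ b → entry A (g * k + u + inverseℕ π b) (b * L + c))

  windowZeros : ℕ → ℕ
  windowZeros u = ∑ L′ (λ g → ∑ L (λ c → bit (not (window u g c))))

  columnZeros : ℕ → ℕ
  columnZeros c = ∑ n (λ r → bit (not (entry A r c)))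

  rows-disjoint : ∀ i → i < k → (h : ℕ → ℕ) → ∑ k (λ u → ∑ L′ (λ g → h (g * k + u + i))) ≤ ∑ n h
  rows-disjoint i i<k h = begin
    ∑ k (λ u → ∑ L′ (λ g → h (g * k + u + i)))   ≡⟨ ∑-swap k L′ _ ⟩
    ∑ L′ (λ g → ∑ k (λ u → h (g * k + u + i)))   ≡⟨ ∑-* L′ k (λ w → h (w + i)) ⟨
    ∑ (L′ * k) (λ w → h (w + i))                 ≤⟨ ∑-shift (L′ * k) i h ⟩
    ∑ (i + L′ * k) h                             ≤⟨ ∑-monoˡ-≤ h i+L′k≤n ⟩
    ∑ n h                                        ∎
    where
    open ≤-Reasoning
    i+L′k≤n : i + L′ * k ≤ n
    i+L′k≤n = <⇒≤ (subst (i + L′ * k <_) (sym n≡L*k) (+-monoˡ-< (L′ * k) i<k))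

  ∑windowZeros≤zeros : ∑ k windowZeros ≤ zeros A
  ∑windowZeros≤zeros = begin
    ∑ k windowZeros
      ≤⟨ ∑-mono-≤ k (λ u _ → ∑-mono-≤ L′ (λ g _ → ∑-mono-≤ L (λ c _ →
           bit-not-all<≤∑ k (λ b → entry A (g * k + u + inverseℕ π b) (b * L + c))))) ⟩
    ∑ k (λ u → ∑ L′ (λ g → ∑ L (λ c → ∑ k (λ b → Z b c u g))))
      ≡⟨ ∑-cong k (λ u _ → ∑-cong L′ (λ g _ → ∑-swap L k (λ c b → Z b c u g))) ⟩
    ∑ k (λ u → ∑ L′ (λ g → ∑ k (λ b → ∑ L (λ c → Z b c u g))))
      ≡⟨ ∑-swap₃ k L′ k (λ u g b → ∑ L (λ c → Z b c u g)) ⟩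
    ∑ k (λ b → ∑ k (λ u → ∑ L′ (λ g → ∑ L (λ c → Z b c u g))))
      ≡⟨ ∑-cong k (λ b _ → ∑-swap₃ k L′ L (λ u g c → Z b c u g)) ⟩
    ∑ k (λ b → ∑ L (λ c → ∑ k (λ u → ∑ L′ (λ g → Z b c u g))))
      ≤⟨ ∑-mono-≤ k (λ b b<k → ∑-mono-≤ L (λ c _ →
           rows-disjoint (inverseℕ π b) (inverseℕ-< π b<k) (λ r → bit (not (entry A r (b * L + c)))))) ⟩
    ∑ k (λ b → ∑ L (λ c → columnZeros (b * L + c)))
      ≡⟨ trans (cong (λ s → ∑ s columnZeros) n≡k*L) (∑-* k L columnZeros) ⟨
    ∑ n columnZeros
      ≡⟨ trans (∑-swap n n (λ c r → bit (not (entry A r c)))) (sym (zeros≡∑ A)) ⟩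
    zeros A ∎
    where
    open ≤-Reasoning
    Z : ℕ → ℕ → ℕ → ℕ → ℕ
    Z b c u g = bit (not (entry A (g * k + u + inverseℕ π b) (b * L + c)))

  compressed : ℕ → ℕ → BMat L′ L′
  compressed u c₀ g c′ = window u (toℕ g) (punchInℕ c₀ (toℕ c′))

  zeros-compressed : ∀ u c₀ →
    zeros (compressed u c₀) ≡ ∑ L′ (λ g → ∑ L′ (λ c′ → bit (not (window u g (punchInℕ c₀ c′)))))
  zeros-compressed u c₀ = sumFin≡∑ L′ (λ _ → sumFin≡∑ L′ (λ _ → refl))

  compressed-contains⇒contains : ∀ {u c₀} → u < k →
    Contains (compressed u c₀) (permMat ρ) → Contains A (grid π ρ)
  compressed-contains⇒contains {u} {c₀} u<k (f , g , f-mono , g-mono , f×g-ones) =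
    F , G , F-mono , G-mono , F×G-ones
    where
    rowH : Fin l → ℕ
    rowH j = toℕ (f j) * k + u

    colΨ : Fin l → ℕ
    colΨ q = punchInℕ c₀ (toℕ (g q))

    colΨ<L : ∀ q s → colΨ q < L + s
    colΨ<L q s = <-≤-trans (punchInℕ-< c₀ (toℕ<n (g q))) (m≤m+n L s)

    rowValue colValue : Fin (k * l) → ℕ
    rowValue x = digitMap {l} {k} rowH toℕ (cast (*-comm k l) x)
    colValue y = digitMap {k} {l} (λ b → toℕ b * L) colΨ y

    rowValue<n : ∀ x → rowValue x < n
    rowValue<n x =
      subst₂ _<_ (sym (+-assoc (toℕ (f j) * k) u (toℕ i))) (trans (+-comm (L′ * k) k) (sym n≡L*k))
        (*+-< k k (toℕ<n (f j)) (+-mono-< u<k (toℕ<n i)))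
      where
      j : Fin l
      j = proj₁ (remQuot {l} k (cast (*-comm k l) x))
      i : Fin k
      i = proj₂ (remQuot {l} k (cast (*-comm k l) x))

    colValue<n : ∀ y → colValue y < n
    colValue<n y = subst (colValue y <_) (trans (+-identityʳ (k * L)) (sym n≡k*L))
      (*+-< L 0 (toℕ<n (proj₁ (remQuot {k} l y))) (colΨ<L (proj₂ (remQuot {k} l y)) 0))

    F G : Fin (k * l) → Fin n
    F x = fromℕ< (rowValue<n x)
    G y = fromℕ< (colValue<n y)

    rowStep : ∀ {j j′} i i′ → j Fin.< j′ → rowH j + toℕ i < rowH j′ + toℕ i′
    rowStep {j} {j′} i i′ j<j′ =
      subst₂ _<_ (sym (+-assoc (toℕ (f j) * k) u (toℕ i))) (sym (+-assoc (toℕ (f j′) * k) u (toℕ i′)))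
      (*+-< k (u + toℕ i′) (f-mono j j′ j<j′)
        (<-≤-trans (+-monoʳ-< u (toℕ<n i)) (≤-trans (≤-reflexive (+-comm u k)) (+-monoʳ-≤ k (m≤m+n u _)))))

    F-mono : ∀ x y → x Fin.< y → F x Fin.< F y
    F-mono x y x<y = subst₂ _<_ (sym (toℕ-fromℕ< (rowValue<n x))) (sym (toℕ-fromℕ< (rowValue<n y)))
      (digitMap-mono {l} {k} rowH toℕ rowStep (λ i<i′ → i<i′)
        (subst₂ _<_ (sym (toℕ-cast (*-comm k l) x)) (sym (toℕ-cast (*-comm k l) y)) x<y))

    G-mono : ∀ x y → x Fin.< y → G x Fin.< G y
    G-mono x y x<y = subst₂ _<_ (sym (toℕ-fromℕ< (colValue<n x))) (sym (toℕ-fromℕ< (colValue<n y)))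
      (digitMap-mono {k} {l} (λ b → toℕ b * L) colΨ (λ _ q′ b<b′ → *+-< L (colΨ q′) b<b′ (colΨ<L _ _))
        (λ {q} {q′} q<q′ → punchInℕ-mono-< c₀ (g-mono q q′ q<q′)) x<y)

    F×G-ones : ∀ r c → grid π ρ r c → A (F r) (G c) ≡ true
    F×G-ones r c (i , j , r≡ , c≡) = begin
      A (F r) (G c)                                     ≡⟨ entry-toℕ A (F r) (G c) ⟨
      entry A (toℕ (F r)) (toℕ (G c))                   ≡⟨ cong₂ (entry A) row≡ col≡ ⟩
      entry A (rowH j + toℕ i) (b * L + c′)
        ≡⟨ cong (λ x → entry A (rowH j + x) (b * L + c′)) (inverseℕ-toℕ π i) ⟨
      entry A (rowH j + inverseℕ π b) (b * L + c′)
        ≡⟨ all<-true k (λ b′ → entry A (rowH j + inverseℕ π b′) (b′ * L + c′))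
                       (f×g-ones j (ρ ⟨$⟩ʳ j) refl) (toℕ<n (π ⟨$⟩ʳ i)) ⟩
      true                                              ∎
      where
      open ≡-Reasoning
      b c′ : ℕ
      b = toℕ (π ⟨$⟩ʳ i)
      c′ = colΨ (ρ ⟨$⟩ʳ j)
      row≡ : toℕ (F r) ≡ rowH j + toℕ i
      row≡ = trans (toℕ-fromℕ< (rowValue<n r))
                   (digitMap-digits {l} {k} rowH toℕ _ j i (trans (toℕ-cast (*-comm k l) r) r≡))
      col≡ : toℕ (G c) ≡ b * L + c′
      col≡ = trans (toℕ-fromℕ< (colValue<n c))
                   (digitMap-digits {k} {l} (λ b → toℕ b * L) colΨ c (π ⟨$⟩ʳ i) (ρ ⟨$⟩ʳ j) c≡)

  zeros-lower-bound : 0 < k → Avoids A (grid π ρ) → ∀ e →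
    (∀ (W : BMat L′ L′) → Avoids W (permMat ρ) → ones W ≤ e) →
    k * (L′ * L′ ∸ e) < zeros A
  zeros-lower-bound k>0 A-avoids e ex-bound with L′ * L′ ∸ e in D≡
  ... | zero = ≰⇒> λ zs≤k*0 →
    A-avoids (zeros≡0⇒contains A (grid π ρ) (n≤0⇒n≡0 (≤-trans zs≤k*0 (≤-reflexive (*-zeroʳ k)))) kl≤n kl≤n)
    where
    kl≤n : k * l ≤ n
    kl≤n = ≤-trans (*-monoʳ-≤ k l≤L) (≤-reflexive (sym n≡k*L))
  ... | suc D′ = ≰⇒> λ zs≤k*D →
    let u , u<k , windowZeros≤D = pigeonhole k D windowZeros
          (≤-<-trans (≤-trans ∑windowZeros≤zeros zs≤k*D) (*-monoʳ-< k {{>-nonZero k>0}} (n<1+n D)))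
        c₀ , _ , rest<D = removable-column L′ L′ D (λ g c → bit (not (window u g c))) z<s windowZeros≤D
    in <⇒≱ (zeros<∸⇒<ones (compressed u c₀) e (subst₂ _<_ (sym (zeros-compressed u c₀)) (sym D≡) rest<D))
           (ex-bound (compressed u c₀) (A-avoids ∘ compressed-contains⇒contains u<k))
    where
    D : ℕ
    D = suc D′

square : ∀ x → x ^ 2 ≡ x * x
square x = cong (x *_) (*-identityʳ x)

lemma5p1 : (k l m : ℕ) → 2 ≤ k → 2 ≤ l → 1 ≤ m →
    (π : Permutation′ k) (ρ : Permutation′ l) (e₁ e₂ : ℕ) →
    IsEx (m * (k * l)) (grid π ρ) e₁ →
    IsEx (m * l ∸ 1) (permMat ρ) e₂ →
    e₁ + k * ((m * l ∸ 1) ^ 2 ∸ e₂) < (m * (k * l)) ^ 2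
lemma5p1 k l m k≥2 l≥2 m≥1 π ρ e₁ e₂ ((A , A-avoids , onesA≡e₁) , _) (_ , ex₂-bound) = begin-strict
  e₁ + k * (L′ ^ 2 ∸ e₂)     ≡⟨ cong (λ s → e₁ + k * (s ∸ e₂)) (square L′) ⟩
  e₁ + k * (L′ * L′ ∸ e₂)    <⟨ +-monoʳ-< e₁ (zeros-lower-bound k>0 A-avoids e₂ ex₂-bound) ⟩
  e₁ + zeros A               ≡⟨ cong (_+ zeros A) onesA≡e₁ ⟨
  ones A + zeros A           ≡⟨ ones+zeros A ⟩
  n * n                      ≡⟨ square n ⟨
  n ^ 2                      ∎
  where
  open ≤-Reasoning
  L′ n : ℕ
  L′ = m * l ∸ 1
  n = m * (k * l)
  k>0 : 0 < k
  k>0 = <-≤-trans z<s k≥2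
  L≡m*l : suc L′ ≡ m * l
  L≡m*l = trans (+-comm 1 L′) (m∸n+n≡m (*-mono-≤ m≥1 (<-≤-trans z<s l≥2)))
  l≤L : l ≤ suc L′
  l≤L = subst (l ≤_) (sym L≡m*l) (m≤n*m l m {{>-nonZero m≥1}})
  n≡L*k : n ≡ suc L′ * k
  n≡L*k = trans (cong (m *_) (*-comm k l)) (trans (sym (*-assoc m l k)) (cong (_* k) (sym L≡m*l)))
  open Compression l≤L n≡L*k π ρ A using (zeros-lower-bound)
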